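{- For every integer $k\geq 2$, $\mathrm{cat}(C_{2k+1})=\mathrm{cat}(C_{2k})=\lceil \log_2 (2k)\rceil+1$. Moreover $\mathrm{cat}(C_3)=2$. Here $C_m$ denotes the cycle on $m$ vertices.
   Context: Cat Herding is a two-player game on a finite simple graph $G$ between a cat and a herder. First the cat places its token on a starting vertex. Then the players alternate, the herder moving first: on the herder's turn it deletes one edge of the current graph (a "cut"); on the cat's turn the cat must move its token along a path of the current graph to a different vertex. The game ends when the cat's current vertex has no incident edges. The score is the total number of edges deleted; the herder minimizes and the cat maximizes it. For $v\in V(G)$, $\mathrm{cat}(G,v)$ is the optimal-play score when the cat starts at $v$, and $\mathrm{cat}(G)=\max_{v\in V(G)}\mathrm{cat}(G,v)$. -}

module Defs where

open import Data.Nat using (ℕ; zero; suc; _+_; _*_; _≡ᵇ_; _≤_)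
open import Data.Bool using (Bool; true; false; _∧_; _∨_; not; T)
open import Data.Fin using (Fin; toℕ)
open import Data.Fin.Properties using (_≟_)
open import Data.Product using (Σ; _×_; _,_)
open import Data.Sum using (_⊎_)
open import Relation.Binary.PropositionalEquality using (_≡_; _≢_)
open import Relation.Nullary using (¬_)
open import Relation.Nullary.Decidable using (⌊_⌋)
open import Relation.Binary.Construct.Closure.ReflexiveTransitive using (Star)

-- A (finite) graph on vertex set Fin n, given by its adjacency relation.
-- All graphs used below are simple (symmetric, irreflexive adjacency),
-- and edge deletion preserves this.
Graph : ℕ → Set
Graph n = Fin n → Fin n → Bool

Edge : ∀ {n} → Graph n → Fin n → Fin n → Set
Edge G x y = T (G x y)

delEdge : ∀ {n} → Graph n → Fin n → Fin n → Graph n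
delEdge G x y a b =
  G a b ∧ not ((⌊ a ≟ x ⌋ ∧ ⌊ b ≟ y ⌋) ∨ (⌊ a ≟ y ⌋ ∧ ⌊ b ≟ x ⌋))

Isolated : ∀ {n} → Graph n → Fin n → Set
Isolated G v = ∀ w → ¬ Edge G v w

Reach : ∀ {n} → Graph n → Fin n → Fin n → Set
Reach G = Star (Edge G)

-- Positions: cat on vertex v of current graph G, herder to move.
-- HerderBound G v s : the herder can force that at most s further edges
-- are deleted (counted from this position on).
data HerderBound {n : ℕ} (G : Graph n) (v : Fin n) : ℕ → Set where
  over : ∀ {s} → Isolated G v → HerderBound G v s
  cut  : ∀ {s} (x y : Fin n) → Edge G x y →
         (∀ w → w ≢ v → Reach (delEdge G x y) v w →
            HerderBound (delEdge G x y) w s) →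
         HerderBound G v (suc s)

-- CatBound G v s : the cat can force that at least s further edges are deleted.
data CatBound {n : ℕ} (G : Graph n) (v : Fin n) : ℕ → Set where
  start : CatBound G v zero
  step  : ∀ {s} → ¬ Isolated G v →
          (∀ x y → Edge G x y →
             s ≡ zero ⊎
             Σ (Fin n) (λ w → w ≢ v × Reach (delEdge G x y) v w ×
                              CatBound (delEdge G x y) w s)) →
          CatBound G v (suc s)

-- cat(G) = s : some starting vertex lets the cat force score ≥ s, and from
-- every starting vertex the herder can force score ≤ s.
CatNumber : ∀ {n} → Graph n → ℕ → Set
CatNumber {n} G s = Σ (Fin n) (λ v → CatBound G v s) × (∀ v → HerderBound G v s)

-- The cycle C_m on vertices 0,…,m-1 (for m ≥ 3): i ~ i+1 and 0 ~ m-1.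
cycleAdj : ℕ → ℕ → ℕ → Bool
cycleAdj m i j = (suc i ≡ᵇ j) ∨ (suc j ≡ᵇ i)
               ∨ ((i ≡ᵇ 0) ∧ (suc j ≡ᵇ m)) ∨ ((j ≡ᵇ 0) ∧ (suc i ≡ᵇ m))

Cycle : (m : ℕ) → Graph m
Cycle m a b = cycleAdj m (toℕ a) (toℕ b)

-- Both bounds are played out on path segments.  Herder: if the cat is among the first or
-- the last 2^s vertices of the segment it lives on, the herder cuts the edge at the cat
-- towards the farther end; the cat is trapped among at most 2^s vertices, and wherever it
-- moves it is among the first or the last 2^(s-1) of them, so s+1 cuts suffice.  Cat: from
-- a vertex at distance at least ⌊2^s/2⌋ from both ends of a segment with an edge, the cat
-- forces s+1 cuts: a cut away from the segment is answered by a step along it, a cut inside it by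
-- a jump to the centre of the piece containing the cat, which has at least 2^(s-1)+1
-- vertices.  Rotations act transitively on the vertices and on the edges of C_m.  For
-- 2k ≤ m ≤ 2k+1 and t = ⌈log₂ k⌉ the herder first cuts the edge opposite the cat, after
-- which every other vertex is among the first or the last k ≤ 2^t of a path; the cat
-- answers the first cut by moving to the middle of the resulting path, which has
-- m ≥ 2k ≥ 2⌊2^t/2⌋+2 vertices.  Both bounds are t+2 = ⌈log₂ 2k⌉+1.
module Submission where

open import Defs
open import Data.Bool using (true; false; _∧_; not; T)
open import Data.Empty using (⊥-elim)
open import Data.Fin using (Fin; toℕ; zero; suc; fromℕ; fromℕ<; inject₁; lower₁)
open import Data.Fin.Permutation
  using (Permutation′; permutation; _⟨$⟩ʳ_; _⟨$⟩ˡ_; inverseˡ; inverseʳ; id; flip; _∘ₚ_)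
open import Data.Fin.Properties
  using (_≟_; toℕ-injective; toℕ<n; toℕ-fromℕ; toℕ-fromℕ<; toℕ-inject₁; toℕ-inject₁-≢; toℕ-lower₁;
         lower₁-inject₁′; inject₁-lower₁)
import Data.Nat as ℕ
open import Data.Nat using (ℕ; zero; suc; _+_; _*_; _∸_; _^_; _≤_; _<_; z≤n; s≤s; z<s; _≤?_; _<?_;
                            ⌈_/2⌉; >-nonZero)
open import Data.Nat.Induction using (<-wellFounded)
open import Data.Nat.Logarithm using (⌈log₂_⌉; ⌈log₂⌉-mono-≤; ⌈log₂2^n⌉≡n; ⌈log₂2*n⌉≡1+⌈log₂n⌉)
open import Data.Nat.Logarithm.Core using (⌈log2⌉)
open import Data.Nat.Properties hiding (_≟_)
import Data.Product as Prod
open import Data.Product using (Σ; _×_; _,_; proj₁; proj₂)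
import Data.Sum as Sum
open import Data.Sum using (_⊎_; inj₁; inj₂)
open import Function using (_⇔_; mk⇔; Equivalence; _∘_)
import Function.Properties.Equivalence as ⇔
open import Induction.WellFounded using (Acc; acc)
open import Relation.Binary.Construct.Closure.ReflexiveTransitive using (ε; _◅_; _◅◅_; gmap)
open import Relation.Binary.PropositionalEquality
open import Relation.Nullary using (¬_; Dec; yes; no; does; _×-dec_; _⊎-dec_)
open import Relation.Nullary.Decidable using (does-⇔; isYes≗does)

private
  variable
    n s : ℕ
    G H : Graph n
    a b v x y : Fin n

-- Edge deletion

T-does : ∀ {A : Set} (d : Dec A) → T (does d) ⇔ A
T-does (yes p) = mk⇔ (λ _ → p) (λ _ → _)
T-does (no ¬p) = mk⇔ (λ ()) ¬p

T-∧-not-does : ∀ {A : Set} {g} (d : Dec A) → T (g ∧ not (does d)) ⇔ (T g × ¬ A)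
T-∧-not-does {g = true}  (yes p) = mk⇔ (λ ()) (λ (_ , ¬p) → ¬p p)
T-∧-not-does {g = true}  (no ¬p) = mk⇔ (λ _ → _ , ¬p) (λ _ → _)
T-∧-not-does {g = false} _       = mk⇔ (λ ()) proj₁

SameEdge : Fin n → Fin n → Fin n → Fin n → Set
SameEdge x y a b = (a ≡ x × b ≡ y) ⊎ (a ≡ y × b ≡ x)

sameEdge? : (x y a b : Fin n) → Dec (SameEdge x y a b)
sameEdge? x y a b = (a ≟ x ×-dec b ≟ y) ⊎-dec (a ≟ y ×-dec b ≟ x)

SameEdge-flip : SameEdge x y a b → SameEdge x y b a
SameEdge-flip = Sum.swap ∘ Sum.map Prod.swap Prod.swap

SameEdge-image : ∀ {f : Fin n → Fin n} {p q} → (∀ {a b} → f a ≡ f b → a ≡ b) →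
                 SameEdge x y (f p) (f q) → SameEdge x y (f a) (f b) ⇔ SameEdge p q a b
SameEdge-image {f = f} f-inj (inj₁ (refl , refl)) =
  mk⇔ (Sum.map (Prod.map f-inj f-inj) (Prod.map f-inj f-inj))
      (Sum.map (Prod.map (cong f) (cong f)) (Prod.map (cong f) (cong f)))
SameEdge-image {f = f} f-inj (inj₂ (refl , refl)) =
  mk⇔ (Sum.swap ∘ Sum.map (Prod.map f-inj f-inj) (Prod.map f-inj f-inj))
      (Sum.map (Prod.map (cong f) (cong f)) (Prod.map (cong f) (cong f)) ∘ Sum.swap)

delEdge≡ : ∀ (G : Graph n) x y a b → delEdge G x y a b ≡ G a b ∧ not (does (sameEdge? x y a b))
delEdge≡ G x y a b
  rewrite isYes≗does (a ≟ x) | isYes≗does (b ≟ y) | isYes≗does (a ≟ y) | isYes≗does (b ≟ x)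
  = refl

Edge-delEdge : ∀ (G : Graph n) x y {a b} → Edge (delEdge G x y) a b ⇔ (Edge G a b × ¬ SameEdge x y a b)
Edge-delEdge G x y {a} {b} =
  subst (λ β → T β ⇔ (Edge G a b × ¬ SameEdge x y a b)) (sym (delEdge≡ G x y a b))
        (T-∧-not-does (sameEdge? x y a b))

delEdge⁻ : ∀ (G : Graph n) x y {a b} → Edge (delEdge G x y) a b → Edge G a b
delEdge⁻ G x y e = proj₁ (Equivalence.to (Edge-delEdge G x y) e)

delEdge-deleted : ∀ (G : Graph n) x y {a b} → Edge (delEdge G x y) a b → ¬ SameEdge x y a b
delEdge-deleted G x y e = proj₂ (Equivalence.to (Edge-delEdge G x y) e)

delEdge⁺ : ∀ (G : Graph n) x y {a b} → Edge G a b → ¬ SameEdge x y a b → Edge (delEdge G x y) a b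
delEdge⁺ G x y e ¬same = Equivalence.from (Edge-delEdge G x y) (e , ¬same)

-- Graph isomorphisms

record _≅_ (G H : Graph n) : Set where
  field
    perm      : Permutation′ n
    preserves : ∀ a b → H (perm ⟨$⟩ʳ a) (perm ⟨$⟩ʳ b) ≡ G a b

  to : Fin n → Fin n
  to a = perm ⟨$⟩ʳ a

  from : Fin n → Fin n
  from a = perm ⟨$⟩ˡ a

  from-to : ∀ a → from (to a) ≡ a
  from-to a = inverseˡ perm

  to-from : ∀ a → to (from a) ≡ a
  to-from a = inverseʳ perm

  to-injective : to a ≡ to b → a ≡ b
  to-injective {a} {b} eq = trans (sym (from-to a)) (trans (cong from eq) (from-to b))

open _≅_

≅-refl : G ≅ G
≅-refl = record { perm = id ; preserves = λ _ _ → refl }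

≅-sym : G ≅ H → H ≅ G
≅-sym {G = G} {H = H} I = record { perm = flip (perm I) ; preserves = λ a b → begin
  G (from I a) (from I b)               ≡⟨ preserves I _ _ ⟨
  H (to I (from I a)) (to I (from I b)) ≡⟨ cong₂ H (to-from I a) (to-from I b) ⟩
  H a b                                 ∎ }
  where open ≡-Reasoning

≅-trans : ∀ {K : Graph n} → G ≅ H → H ≅ K → G ≅ K
≅-trans I J = record
  { perm = perm I ∘ₚ perm J ; preserves = λ a b → trans (preserves J _ _) (preserves I a b) }

Edge-≅ : (I : G ≅ H) → Edge G a b → Edge H (to I a) (to I b)
Edge-≅ I e = subst T (sym (preserves I _ _)) e

Reach-≅ : (I : G ≅ H) → Reach G a b → Reach H (to I a) (to I b)
Reach-≅ I = gmap (to I) (Edge-≅ I)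

Edge-≅⁻ : (I : G ≅ H) → Edge H (to I a) b → Edge G a (from I b)
Edge-≅⁻ {G = G} {a = a} {b = b} I e = subst (λ u → Edge G u (from I b)) (from-to I a) (Edge-≅ (≅-sym I) e)

Reach-≅⁻ : (I : G ≅ H) → Reach H (to I a) b → Reach G a (from I b)
Reach-≅⁻ {G = G} {a = a} {b = b} I r = subst (λ u → Reach G u (from I b)) (from-to I a) (Reach-≅ (≅-sym I) r)

delEdge-≅ : ∀ {p q} (I : G ≅ H) → SameEdge x y (to I p) (to I q) → delEdge G p q ≅ delEdge H x y
delEdge-≅ {G = G} {H = H} {x = x} {y = y} {p = p} {q = q} I same = record
  { perm = perm I ; preserves = λ a b → begin
    delEdge H x y (to I a) (to I b)
      ≡⟨ delEdge≡ H x y _ _ ⟩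
    H (to I a) (to I b) ∧ not (does (sameEdge? x y (to I a) (to I b)))
      ≡⟨ cong₂ (λ g e → g ∧ not e) (preserves I a b)
               (does-⇔ (SameEdge-image (to-injective I) same)
                       (sameEdge? x y (to I a) (to I b)) (sameEdge? p q a b)) ⟩
    G a b ∧ not (does (sameEdge? p q a b))
      ≡⟨ delEdge≡ G p q a b ⟨
    delEdge G p q a b
      ∎ }
  where open ≡-Reasoning

CatMove : Graph n → Fin n → ℕ → Set
CatMove {n} G v s = Σ (Fin n) λ w → w ≢ v × Reach G v w × CatBound G w s

HerderBound-≅ : (I : G ≅ H) → HerderBound G v s → HerderBound H (to I v) s
HerderBound-≅ I (over isolated) = over λ w e → isolated (from I w) (Edge-≅⁻ I e)
HerderBound-≅ {H = H} {s = suc s} I (cut x y e afterMove) =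
  cut (to I x) (to I y) (Edge-≅ I e) λ w w≢Iv r →
    subst (λ u → HerderBound (delEdge H (to I x) (to I y)) u s) (to-from I w)
      (HerderBound-≅ I′ (afterMove (from I w) (λ { refl → w≢Iv (sym (to-from I w)) }) (Reach-≅⁻ I′ r)))
  where I′ = delEdge-≅ {x = to I x} {y = to I y} I (inj₁ (refl , refl))

mutual
  CatBound-≅ : (I : G ≅ H) → CatBound G v s → CatBound H (to I v) s
  CatBound-≅ I start = start
  CatBound-≅ I (step notIsolated reply) =
    step (λ isolated → notIsolated λ w e → isolated (to I w) (Edge-≅ I e))
         λ x y e → Sum.map₂ (CatMove-≅ (delEdge-≅ I (inj₁ (to-from I x , to-from I y))))
                            (reply (from I x) (from I y) (Edge-≅ (≅-sym I) e))

  CatMove-≅ : (I : G ≅ H) → CatMove G v s → CatMove H (to I v) s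
  CatMove-≅ I (w , w≢v , r , cb) = to I w , w≢v ∘ to-injective I , Reach-≅ I r , CatBound-≅ I cb

Reach-≢-notIsolated : ∀ {w} → Reach G v w → w ≢ v → ¬ Isolated G v
Reach-≢-notIsolated ε       w≢v _        = w≢v refl
Reach-≢-notIsolated (e ◅ _) _   isolated = isolated _ e

-- Path segments

_⋖_ : Fin n → Fin n → Set
a ⋖ b = toℕ b ≡ suc (toℕ a)

_∈[_,_] : Fin n → ℕ → ℕ → Set
a ∈[ lo , hi ] = lo ≤ toℕ a × toℕ a ≤ hi

Confined : Graph n → ℕ → ℕ → Set
Confined G lo hi = ∀ {a b} → Edge G a b → a ∈[ lo , hi ] → (a ⋖ b ⊎ b ⋖ a) × b ∈[ lo , hi ]

HasPath : Graph n → ℕ → ℕ → Set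
HasPath G lo hi = ∀ {a b} → a ⋖ b → lo ≤ toℕ a → toℕ b ≤ hi → Edge G a b × Edge G b a

Segment : Graph n → ℕ → ℕ → Set
Segment G lo hi = Confined G lo hi × HasPath G lo hi

OnPath : Fin n → Fin n → ℕ → ℕ → Set
OnPath {n} x y lo hi =
  Σ (Fin n) λ p → Σ (Fin n) λ q → p ⋖ q × lo ≤ toℕ p × toℕ q ≤ hi × SameEdge x y p q

OffPath : Fin n → Fin n → ℕ → ℕ → Set
OffPath x y lo hi = ∀ {a b} → a ⋖ b → lo ≤ toℕ a → toℕ b ≤ hi → ¬ SameEdge x y a b

⋖⇒< : a ⋖ b → toℕ a < toℕ b
⋖⇒< a⋖b = ≤-reflexive (sym a⋖b)

⋖-irrefl : ¬ a ⋖ a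
⋖-irrefl a⋖a = 1+n≢n (sym a⋖a)

⋖-next : (a : Fin n) → suc (toℕ a) < n → Σ (Fin n) (a ⋖_)
⋖-next a a+1<n = fromℕ< a+1<n , toℕ-fromℕ< a+1<n

⋖-prev : (b : Fin n) → 0 < toℕ b → Σ (Fin n) (_⋖ b)
⋖-prev (suc i) _ = inject₁ i , cong suc (sym (toℕ-inject₁ i))

⋖-SameEdge : ∀ {p q} → p ⋖ q → a ⋖ b → SameEdge x y p q → SameEdge x y a b → a ≡ p × b ≡ q
⋖-SameEdge p⋖q a⋖b (inj₁ (refl , refl)) (inj₁ a≡p×b≡q)       = a≡p×b≡q
⋖-SameEdge p⋖q a⋖b (inj₁ (refl , refl)) (inj₂ (refl , refl)) = ⊥-elim (<-asym (⋖⇒< p⋖q) (⋖⇒< a⋖b))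
⋖-SameEdge p⋖q a⋖b (inj₂ (refl , refl)) (inj₁ (refl , refl)) = ⊥-elim (<-asym (⋖⇒< p⋖q) (⋖⇒< a⋖b))
⋖-SameEdge p⋖q a⋖b (inj₂ (refl , refl)) (inj₂ a≡p×b≡q)       = a≡p×b≡q

∈-unique : ∀ {lo hi} → hi ≤ lo → a ∈[ lo , hi ] → b ∈[ lo , hi ] → a ≡ b
∈-unique hi≤lo (lo≤a , a≤hi) (lo≤b , b≤hi) =
  toℕ-injective (≤-antisym (≤-trans a≤hi (≤-trans hi≤lo lo≤b)) (≤-trans b≤hi (≤-trans hi≤lo lo≤a)))

onPath-or-offPath : ∀ (x y : Fin n) lo hi → OnPath x y lo hi ⊎ OffPath x y lo hi
onPath-or-offPath x y lo hi with (toℕ y ℕ.≟ suc (toℕ x)) ×-dec (lo ≤? toℕ x) ×-dec (toℕ y ≤? hi)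
... | yes (x⋖y , lo≤x , y≤hi) = inj₁ (x , y , x⋖y , lo≤x , y≤hi , inj₁ (refl , refl))
... | no ¬x⋖y with (toℕ x ℕ.≟ suc (toℕ y)) ×-dec (lo ≤? toℕ y) ×-dec (toℕ x ≤? hi)
...   | yes (y⋖x , lo≤y , x≤hi) = inj₁ (y , x , y⋖x , lo≤y , x≤hi , inj₂ (refl , refl))
...   | no ¬y⋖x = inj₂ λ where
          a⋖b lo≤a b≤hi (inj₁ (refl , refl)) → ¬x⋖y (a⋖b , lo≤a , b≤hi)
          a⋖b lo≤a b≤hi (inj₂ (refl , refl)) → ¬y⋖x (a⋖b , lo≤a , b≤hi)

OffPath-outside : ∀ {p q lo hi} → p ⋖ q → SameEdge x y p q → toℕ q ≤ lo ⊎ hi ≤ toℕ p →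
                  OffPath x y lo hi
OffPath-outside p⋖q same outside a⋖b lo≤a b≤hi same′ with ⋖-SameEdge p⋖q a⋖b same same′
... | refl , refl = Sum.[ (λ q≤lo → <-irrefl refl (≤-trans (⋖⇒< p⋖q) (≤-trans q≤lo lo≤a)))
                        , (λ hi≤p → <-irrefl refl (≤-trans (⋖⇒< p⋖q) (≤-trans b≤hi hi≤p))) ] outside

Reach-Confined : ∀ {lo hi w} → Confined G lo hi → v ∈[ lo , hi ] → Reach G v w → w ∈[ lo , hi ]
Reach-Confined conf v∈ ε       = v∈
Reach-Confined conf v∈ (e ◅ r) = Reach-Confined conf (proj₂ (conf e v∈)) r

Confined-isolated : ∀ {lo hi} → Confined G lo hi → hi ≤ lo → v ∈[ lo , hi ] → Isolated G v
Confined-isolated conf hi≤lo v∈ w e with conf e v∈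
... | v⋖w , w∈ with ∈-unique hi≤lo v∈ w∈
...   | refl = Sum.[ ⋖-irrefl , ⋖-irrefl ] v⋖w

Confined-cut-left : ∀ {lo hi p q} → Confined G lo hi → p ⋖ q → toℕ p ≤ hi →
                    Confined (delEdge G p q) lo (toℕ p)
Confined-cut-left {G = G} {p = p} {q} conf p⋖q p≤hi {a} {b} e (lo≤a , a≤p)
  with conf (delEdge⁻ G p q e) (lo≤a , ≤-trans a≤p p≤hi)
... | inj₂ b⋖a , lo≤b , _ = inj₂ b⋖a , lo≤b , ≤-trans (<⇒≤ (⋖⇒< b⋖a)) a≤p
... | inj₁ a⋖b , lo≤b , _ with m≤n⇒m<n∨m≡n a≤p
...   | inj₁ a<p = inj₁ a⋖b , lo≤b , ≤-trans (≤-reflexive a⋖b) a<p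
...   | inj₂ a≡p = ⊥-elim (delEdge-deleted G p q e (inj₁ (toℕ-injective a≡p , b≡q)))
  where b≡q = toℕ-injective (trans a⋖b (trans (cong suc a≡p) (sym p⋖q)))

Confined-cut-right : ∀ {lo hi p q} → Confined G lo hi → p ⋖ q → lo ≤ toℕ q →
                     Confined (delEdge G p q) (toℕ q) hi
Confined-cut-right {G = G} {p = p} {q} conf p⋖q lo≤q {a} {b} e (q≤a , a≤hi)
  with conf (delEdge⁻ G p q e) (≤-trans lo≤q q≤a , a≤hi)
... | inj₁ a⋖b , _ , b≤hi = inj₁ a⋖b , ≤-trans q≤a (<⇒≤ (⋖⇒< a⋖b)) , b≤hi
... | inj₂ b⋖a , _ , b≤hi with m≤n⇒m<n∨m≡n q≤a
...   | inj₁ q<a = inj₂ b⋖a , ≤-pred (≤-trans q<a (≤-reflexive b⋖a)) , b≤hi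
...   | inj₂ q≡a = ⊥-elim (delEdge-deleted G p q e (inj₂ (toℕ-injective (sym q≡a) , b≡p)))
  where b≡p = toℕ-injective (suc-injective (trans (sym b⋖a) (trans (sym q≡a) p⋖q)))

HasPath-sub : ∀ {lo hi lo′ hi′} → HasPath G lo hi → lo ≤ lo′ → hi′ ≤ hi → HasPath G lo′ hi′
HasPath-sub path lo≤lo′ hi′≤hi a⋖b lo′≤a b≤hi′ = path a⋖b (≤-trans lo≤lo′ lo′≤a) (≤-trans b≤hi′ hi′≤hi)

HasPath-delEdge : ∀ {lo hi} → HasPath G lo hi → OffPath x y lo hi → HasPath (delEdge G x y) lo hi
HasPath-delEdge {G = G} {x = x} {y} path off a⋖b lo≤a b≤hi =
  delEdge⁺ G x y (proj₁ (path a⋖b lo≤a b≤hi)) (off a⋖b lo≤a b≤hi) ,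
  delEdge⁺ G x y (proj₂ (path a⋖b lo≤a b≤hi)) (off a⋖b lo≤a b≤hi ∘ SameEdge-flip)

HasPath-cut-left : ∀ {lo hi p q} → HasPath G lo hi → p ⋖ q → SameEdge x y p q → toℕ p ≤ hi →
                   HasPath (delEdge G x y) lo (toℕ p)
HasPath-cut-left path p⋖q same p≤hi =
  HasPath-delEdge (HasPath-sub path ≤-refl p≤hi) (OffPath-outside p⋖q same (inj₂ ≤-refl))

HasPath-cut-right : ∀ {lo hi p q} → HasPath G lo hi → p ⋖ q → SameEdge x y p q → lo ≤ toℕ q →
                    HasPath (delEdge G x y) (toℕ q) hi
HasPath-cut-right path p⋖q same lo≤q =
  HasPath-delEdge (HasPath-sub path lo≤q ≤-refl) (OffPath-outside p⋖q same (inj₁ ≤-refl))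

Reach-HasPath-≤ : ∀ {lo hi} d → HasPath G lo hi → toℕ a + d ≡ toℕ b → lo ≤ toℕ a → toℕ b ≤ hi →
                  Reach G a b × Reach G b a
Reach-HasPath-≤ zero path a+0≡b _ _ with toℕ-injective (trans (sym (+-identityʳ _)) a+0≡b)
... | refl = ε , ε
Reach-HasPath-≤ {a = a} {b = b} (suc d) path a+[1+d]≡b lo≤a b≤hi =
  a→c ◅ proj₁ c↔b , proj₂ c↔b ◅◅ (c→a ◅ ε)
  where
  1+a+d≡b : suc (toℕ a + d) ≡ toℕ b
  1+a+d≡b = trans (sym (+-suc (toℕ a) d)) a+[1+d]≡b
  a<b : toℕ a < toℕ b
  a<b = ≤-trans (s≤s (m≤m+n (toℕ a) d)) (≤-reflexive 1+a+d≡b)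
  c = proj₁ (⋖-next a (≤-<-trans a<b (toℕ<n b)))
  a⋖c = proj₂ (⋖-next a (≤-<-trans a<b (toℕ<n b)))
  a→c = proj₁ (path a⋖c lo≤a (≤-trans (≤-reflexive a⋖c) (≤-trans a<b b≤hi)))
  c→a = proj₂ (path a⋖c lo≤a (≤-trans (≤-reflexive a⋖c) (≤-trans a<b b≤hi)))
  c↔b = Reach-HasPath-≤ d path (trans (cong (_+ d) a⋖c) 1+a+d≡b) (≤-trans lo≤a (<⇒≤ (⋖⇒< a⋖c))) b≤hi

Reach-HasPath : ∀ {lo hi} → HasPath G lo hi → a ∈[ lo , hi ] → b ∈[ lo , hi ] → Reach G a b
Reach-HasPath {a = a} {b = b} path (lo≤a , a≤hi) (lo≤b , b≤hi) with ≤-total (toℕ a) (toℕ b)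
... | inj₁ a≤b = proj₁ (Reach-HasPath-≤ (toℕ b ∸ toℕ a) path (m+[n∸m]≡n a≤b) lo≤a b≤hi)
... | inj₂ b≤a = proj₂ (Reach-HasPath-≤ (toℕ a ∸ toℕ b) path (m+[n∸m]≡n b≤a) lo≤b a≤hi)

HasPath-notIsolated : ∀ {n} {G : Graph n} {v : Fin n} {lo hi} →
                      HasPath G lo hi → hi < n → lo < hi → v ∈[ lo , hi ] → ¬ Isolated G v
HasPath-notIsolated {v = v} {lo} {hi} path hi<n lo<hi v∈ with toℕ v ℕ.≟ lo
... | yes v≡lo =
  Reach-≢-notIsolated (Reach-HasPath path v∈ w∈) λ { refl → <-irrefl (trans (sym v≡lo) w≡hi) lo<hi }
  where w≡hi = toℕ-fromℕ< hi<n
        w∈ = ≤-trans (<⇒≤ lo<hi) (≤-reflexive (sym w≡hi)) , ≤-reflexive w≡hi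
... | no v≢lo =
  Reach-≢-notIsolated (Reach-HasPath path v∈ w∈) λ { refl → v≢lo w≡lo }
  where w≡lo = toℕ-fromℕ< (<-trans lo<hi hi<n)
        w∈ = ≤-reflexive (sym w≡lo) , ≤-trans (≤-reflexive w≡lo) (<⇒≤ lo<hi)

Segment-cut-left : ∀ {lo hi p q} → Segment G lo hi → p ⋖ q → toℕ p ≤ hi → Segment (delEdge G p q) lo (toℕ p)
Segment-cut-left (conf , path) p⋖q p≤hi =
  Confined-cut-left conf p⋖q p≤hi , HasPath-cut-left path p⋖q (inj₁ (refl , refl)) p≤hi

Segment-cut-right : ∀ {lo hi p q} → Segment G lo hi → p ⋖ q → lo ≤ toℕ q → Segment (delEdge G p q) (toℕ q) hi
Segment-cut-right (conf , path) p⋖q lo≤q =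
  Confined-cut-right conf p⋖q lo≤q , HasPath-cut-right path p⋖q (inj₁ (refl , refl)) lo≤q

-- The herder on a path

NearEnd : ℕ → ℕ → ℕ → ℕ → Set
NearEnd s lo hi i = suc i ≤ lo + 2 ^ s ⊎ suc hi ≤ i + 2 ^ s

1+m≤m+2^n : ∀ m n → suc m ≤ m + 2 ^ n
1+m≤m+2^n m n = ≤-trans (≤-reflexive (+-comm 1 m)) (+-monoʳ-≤ m (m^n>0 2 n))

NearEnd-short : ∀ s {lo hi i} → suc hi ≤ lo + 2 ^ suc s → lo ≤ i → NearEnd s lo hi i
NearEnd-short s {lo} {hi} {i} short lo≤i with suc i ≤? lo + 2 ^ s
... | yes near = inj₁ near
... | no far   = inj₂ (begin
  suc hi                ≤⟨ short ⟩
  lo + (2 ^ s + (2 ^ s + 0)) ≡⟨ cong (λ t → lo + (2 ^ s + t)) (+-identityʳ (2 ^ s)) ⟩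
  lo + (2 ^ s + 2 ^ s)  ≡⟨ +-assoc lo (2 ^ s) (2 ^ s) ⟨
  lo + 2 ^ s + 2 ^ s    ≤⟨ +-monoˡ-≤ (2 ^ s) (≤-pred (≰⇒> far)) ⟩
  i + 2 ^ s             ∎)
  where open ≤-Reasoning

NearEnd-trichotomy : ∀ s {lo hi i} → lo ≤ i → i ≤ hi → NearEnd s lo hi i →
                     (i < hi × suc i ≤ lo + 2 ^ s) ⊎ (lo < i × suc hi ≤ i + 2 ^ s) ⊎ hi ≤ lo
NearEnd-trichotomy s {lo} {hi} {i} lo≤i i≤hi (inj₁ left) with i <? hi | lo <? i
... | yes i<hi | _        = inj₁ (i<hi , left)
... | no i≮hi  | yes lo<i = inj₂ (inj₁ (lo<i , ≤-trans (s≤s (≮⇒≥ i≮hi)) (1+m≤m+2^n i s)))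
... | no i≮hi  | no lo≮i  = inj₂ (inj₂ (≤-trans (≮⇒≥ i≮hi) (≮⇒≥ lo≮i)))
NearEnd-trichotomy s {lo} {hi} {i} lo≤i i≤hi (inj₂ right) with lo <? i | i <? hi
... | yes lo<i | _        = inj₂ (inj₁ (lo<i , right))
... | no lo≮i  | yes i<hi = inj₁ (i<hi , ≤-trans (s≤s (≮⇒≥ lo≮i)) (1+m≤m+2^n lo s))
... | no lo≮i  | no i≮hi  = inj₂ (inj₂ (≤-trans (≮⇒≥ i≮hi) (≮⇒≥ lo≮i)))

mutual
  herderBound-path : ∀ {n} {G : Graph n} {v : Fin n} s {lo hi} → Segment G lo hi → hi < n →
                     v ∈[ lo , hi ] → NearEnd s lo hi (toℕ v) → HerderBound G v (suc s)
  herderBound-path {v = v} s seg hi<n (lo≤v , v≤hi) near with NearEnd-trichotomy s lo≤v v≤hi near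
  ... | inj₁ (v<hi , short) =
    herderBound-cut s v u (proj₁ (proj₂ seg v⋖u lo≤v (≤-trans (≤-reflexive v⋖u) v<hi)))
                    (Segment-cut-left seg v⋖u v≤hi) (toℕ<n v) (lo≤v , ≤-refl) short
    where u = proj₁ (⋖-next v (≤-trans (s≤s v<hi) hi<n))
          v⋖u = proj₂ (⋖-next v (≤-trans (s≤s v<hi) hi<n))
  ... | inj₂ (inj₁ (lo<v , short)) =
    herderBound-cut s u v (proj₁ (proj₂ seg u⋖v (≤-pred (≤-trans lo<v (≤-reflexive u⋖v))) v≤hi))
                    (Segment-cut-right seg u⋖v (<⇒≤ lo<v)) hi<n (≤-refl , v≤hi) short
    where u = proj₁ (⋖-prev v (≤-<-trans z≤n lo<v))
          u⋖v = proj₂ (⋖-prev v (≤-<-trans z≤n lo<v))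
  ... | inj₂ (inj₂ hi≤lo) = over (Confined-isolated (proj₁ seg) hi≤lo (lo≤v , v≤hi))

  herderBound-cut : ∀ {n} {G : Graph n} {v : Fin n} s {lo hi} x y → Edge G x y →
                    Segment (delEdge G x y) lo hi → hi < n → v ∈[ lo , hi ] → suc hi ≤ lo + 2 ^ s →
                    HerderBound G v (suc s)
  herderBound-cut zero {lo} x y e seg hi<n v∈ short = cut x y e λ w w≢v r →
    ⊥-elim (w≢v (∈-unique hi≤lo (Reach-Confined (proj₁ seg) v∈ r) v∈))
    where hi≤lo = ≤-pred (≤-trans short (≤-reflexive (+-comm lo 1)))
  herderBound-cut (suc s) x y e seg hi<n v∈ short = cut x y e λ w w≢v r →
    let w∈ = Reach-Confined (proj₁ seg) v∈ r in
    herderBound-path s seg hi<n w∈ (NearEnd-short s short (proj₁ w∈))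

-- The cat on a path

⌊2^_/2⌋ : ℕ → ℕ
⌊2^ zero  /2⌋ = 0
⌊2^ suc s /2⌋ = 2 ^ s

⌊2^s/2⌋+⌊2^s/2⌋≤⌊2^[1+s]/2⌋ : ∀ s → ⌊2^ s /2⌋ + ⌊2^ s /2⌋ ≤ ⌊2^ suc s /2⌋
⌊2^s/2⌋+⌊2^s/2⌋≤⌊2^[1+s]/2⌋ zero    = z≤n
⌊2^s/2⌋+⌊2^s/2⌋≤⌊2^[1+s]/2⌋ (suc s) = ≤-reflexive (cong (2 ^ s +_) (sym (+-identityʳ (2 ^ s))))

⌊2^s/2⌋<⌊2^[1+s]/2⌋ : ∀ s → ⌊2^ s /2⌋ < ⌊2^ suc s /2⌋
⌊2^s/2⌋<⌊2^[1+s]/2⌋ zero    = s≤s z≤n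
⌊2^s/2⌋<⌊2^[1+s]/2⌋ (suc s) =
  ≤-trans (1+m≤m+2^n (2 ^ s) s) (≤-reflexive (cong (2 ^ s +_) (sym (+-identityʳ (2 ^ s)))))

Central : ℕ → ℕ → ℕ → ℕ → Set
Central r lo hi i = lo + r ≤ i × i + r ≤ hi

Central⇒∈ : ∀ {r lo hi i} → Central r lo hi i → lo ≤ i × i ≤ hi
Central⇒∈ {r} {lo} {i = i} (lo+r≤i , i+r≤hi) = ≤-trans (m≤m+n lo r) lo+r≤i , ≤-trans (m≤m+n i r) i+r≤hi

Central-avoiding : ∀ r {hi} j → r + r < hi → Σ ℕ λ i → i ≢ j × Central r 0 hi i
Central-avoiding r j r+r<hi with j ℕ.≟ r
... | yes refl = suc r , 1+n≢n , n≤1+n r , r+r<hi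
... | no j≢r   = r , j≢r ∘ sym , ≤-refl , <⇒≤ r+r<hi

module _ (s : ℕ) {lo hi i : ℕ} (central : Central ⌊2^ suc s /2⌋ lo hi i) where
  private
    r = ⌊2^ s /2⌋
    R = ⌊2^ suc s /2⌋
    lo+R≤i = proj₁ central
    i+R≤hi = proj₂ central
    r+r≤R = ⌊2^s/2⌋+⌊2^s/2⌋≤⌊2^[1+s]/2⌋ s
    r<R = ⌊2^s/2⌋<⌊2^[1+s]/2⌋ s
    1+i+r≤hi : suc i + r ≤ hi
    1+i+r≤hi = ≤-trans (≤-reflexive (sym (+-suc i r))) (≤-trans (+-monoʳ-≤ i r<R) i+R≤hi)

  Central-next : Central r lo hi (suc i)
  Central-next = ≤-trans (+-monoʳ-≤ lo (<⇒≤ r<R)) (≤-trans lo+R≤i (n≤1+n i))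
               , 1+i+r≤hi

  Central-left : ∀ {p} → i ≤ p → Central r lo p (lo + r) × lo + r < i
  Central-left {p} i≤p = (≤-refl , lo+r+r≤p) , <-≤-trans (+-monoʳ-< lo r<R) lo+R≤i
    where
    lo+r+r≤p : lo + r + r ≤ p
    lo+r+r≤p = ≤-trans (≤-reflexive (+-assoc lo r r)) (≤-trans (+-monoʳ-≤ lo r+r≤R) (≤-trans lo+R≤i i≤p))

  Central-right : ∀ {q} → q ≤ i → Central r q hi (hi ∸ r) × i < hi ∸ r
  Central-right {q} q≤i = (m+n≤o⇒m≤o∸n (q + r) q+r+r≤hi , ≤-reflexive (m∸n+n≡m r≤hi))
                        , m+n≤o⇒m≤o∸n (suc i) 1+i+r≤hi
    where
    q+r+r≤hi : q + r + r ≤ hi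
    q+r+r≤hi = ≤-trans (≤-reflexive (+-assoc q r r)) (≤-trans (+-mono-≤ q≤i r+r≤R) i+R≤hi)
    r≤hi : r ≤ hi
    r≤hi = ≤-trans (m≤n+m r (q + r)) q+r+r≤hi

mutual
  catBound-path : ∀ {n} {G : Graph n} {v : Fin n} s {lo hi} → HasPath G lo hi → hi < n → lo < hi →
                  Central ⌊2^ s /2⌋ lo hi (toℕ v) → CatBound G v (suc s)
  catBound-path zero path hi<n lo<hi central =
    step (HasPath-notIsolated path hi<n lo<hi (Central⇒∈ central)) λ _ _ _ → inj₁ refl
  catBound-path (suc s) path hi<n lo<hi central =
    step (HasPath-notIsolated path hi<n lo<hi (Central⇒∈ central))
         λ x y _ → inj₂ (catMove-delEdge s x y path hi<n lo<hi central)

  catMove-delEdge : ∀ {n} {G : Graph n} {v : Fin n} s {lo hi} x y → HasPath G lo hi → hi < n → lo < hi →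
                    Central ⌊2^ suc s /2⌋ lo hi (toℕ v) → CatMove (delEdge G x y) v (suc s)
  catMove-delEdge {v = v} s {lo} {hi} x y path hi<n lo<hi central with onPath-or-offPath x y lo hi
  ... | inj₂ off =
    catMove-to s (suc (toℕ v)) (HasPath-delEdge path off) hi<n lo<hi (Central⇒∈ central)
      1+n≢n (Central-next s central)
  ... | inj₁ (p , q , p⋖q , lo≤p , q≤hi , same) with toℕ v ≤? toℕ p
  ...   | yes v≤p =
    catMove-to s (lo + ⌊2^ s /2⌋) (HasPath-cut-left path p⋖q same (≤-trans (<⇒≤ (⋖⇒< p⋖q)) q≤hi))
      (toℕ<n p) (≤-<-trans (m≤m+n lo _) (<-≤-trans lo+r<v v≤p)) (proj₁ (Central⇒∈ central) , v≤p)
      (<⇒≢ lo+r<v) (proj₁ (Central-left s central v≤p))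
    where lo+r<v = proj₂ (Central-left s central v≤p)
  ...   | no v≰p =
    catMove-to s (hi ∸ ⌊2^ s /2⌋) (HasPath-cut-right path p⋖q same (≤-trans lo≤p (<⇒≤ (⋖⇒< p⋖q))))
      hi<n (≤-<-trans q≤v (<-≤-trans v<hi-r (m∸n≤m hi ⌊2^ s /2⌋))) (q≤v , proj₂ (Central⇒∈ central))
      (>⇒≢ v<hi-r) (proj₁ (Central-right s central q≤v))
    where q≤v = ≤-trans (≤-reflexive p⋖q) (≰⇒> v≰p)
          v<hi-r = proj₂ (Central-right s central q≤v)

  catMove-to : ∀ {n} {G : Graph n} {v : Fin n} s {lo hi} i → HasPath G lo hi → hi < n → lo < hi →
               v ∈[ lo , hi ] → i ≢ toℕ v → Central ⌊2^ s /2⌋ lo hi i → CatMove G v (suc s)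
  catMove-to s {lo} {hi} i path hi<n lo<hi v∈ i≢v central =
    w , (λ w≡v → i≢v (trans (sym w≡i) (cong toℕ w≡v))) , Reach-HasPath path v∈ w∈ ,
    catBound-path s path hi<n lo<hi (subst (Central ⌊2^ s /2⌋ lo hi) (sym w≡i) central)
    where
    i<n = ≤-<-trans (proj₂ (Central⇒∈ central)) hi<n
    w = fromℕ< i<n
    w≡i = toℕ-fromℕ< i<n
    w∈ = subst (λ j → lo ≤ j × j ≤ hi) (sym w≡i) (Central⇒∈ central)

-- Rotations of the cycle

CycleAdjacent : ℕ → ℕ → ℕ → Set
CycleAdjacent m i j = suc i ≡ j ⊎ suc j ≡ i ⊎ (i ≡ 0 × suc j ≡ m) ⊎ (j ≡ 0 × suc i ≡ m)

cycleAdjacent? : ∀ m i j → Dec (CycleAdjacent m i j)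
cycleAdjacent? m i j =
  suc i ℕ.≟ j ⊎-dec suc j ℕ.≟ i ⊎-dec (i ℕ.≟ 0 ×-dec suc j ℕ.≟ m) ⊎-dec (j ℕ.≟ 0 ×-dec suc i ℕ.≟ m)

module _ {n : ℕ} where

  rot : Fin (suc n) → Fin (suc n)
  rot a with n ℕ.≟ toℕ a
  ... | yes _   = zero
  ... | no n≢a = suc (lower₁ a n≢a)

  unrot : Fin (suc n) → Fin (suc n)
  unrot zero    = fromℕ n
  unrot (suc a) = inject₁ a

  rot-unrot : ∀ a → rot (unrot a) ≡ a
  rot-unrot zero with n ℕ.≟ toℕ (fromℕ n)
  ... | yes _   = refl
  ... | no n≢n = ⊥-elim (n≢n (sym (toℕ-fromℕ n)))
  rot-unrot (suc a) with n ℕ.≟ toℕ (inject₁ a)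
  ... | yes n≡a = ⊥-elim (toℕ-inject₁-≢ a n≡a)
  ... | no n≢a  = cong suc (lower₁-inject₁′ a n≢a)

  unrot-rot : ∀ a → unrot (rot a) ≡ a
  unrot-rot a with n ℕ.≟ toℕ a
  ... | yes n≡a = toℕ-injective (trans (toℕ-fromℕ n) n≡a)
  ... | no n≢a  = inject₁-lower₁ a n≢a

  rot-injective : rot a ≡ rot b → a ≡ b
  rot-injective {a} {b} eq = trans (sym (unrot-rot a)) (trans (cong unrot eq) (unrot-rot b))

  rot-fromℕ : rot (fromℕ n) ≡ zero
  rot-fromℕ = rot-unrot zero

  toℕ-rot : n ≢ toℕ a → toℕ (rot a) ≡ suc (toℕ a)
  toℕ-rot {a} n≢a with n ℕ.≟ toℕ a
  ... | yes n≡a = ⊥-elim (n≢a n≡a)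
  ... | no n≢a′ = cong suc (toℕ-lower₁ a n≢a′)

  ≡rot⇔ : b ≡ rot a ⇔ (suc (toℕ a) ≡ toℕ b ⊎ (toℕ b ≡ 0 × suc (toℕ a) ≡ suc n))
  ≡rot⇔ {b} {a} with n ℕ.≟ toℕ a
  ... | yes n≡a = mk⇔ (λ { refl → inj₂ (refl , cong suc (sym n≡a)) }) λ where
          (inj₁ 1+a≡b)  → ⊥-elim (<-irrefl (sym (trans (cong suc n≡a) 1+a≡b)) (toℕ<n b))
          (inj₂ (b≡0 , _)) → toℕ-injective b≡0
  ... | no n≢a = mk⇔ (λ { refl → inj₁ (cong suc (sym (toℕ-lower₁ a n≢a))) }) λ where
          (inj₁ 1+a≡b)  → toℕ-injective (trans (sym 1+a≡b) (cong suc (sym (toℕ-lower₁ a n≢a))))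
          (inj₂ (_ , 1+a≡1+n)) → ⊥-elim (n≢a (sym (suc-injective 1+a≡1+n)))

  cycleAdjacent⇔ : CycleAdjacent (suc n) (toℕ a) (toℕ b) ⇔ (b ≡ rot a ⊎ a ≡ rot b)
  cycleAdjacent⇔ = mk⇔
    (λ where
      (inj₁ 1+a≡b)                        → inj₁ (Equivalence.from ≡rot⇔ (inj₁ 1+a≡b))
      (inj₂ (inj₁ 1+b≡a))                 → inj₂ (Equivalence.from ≡rot⇔ (inj₁ 1+b≡a))
      (inj₂ (inj₂ (inj₁ a≡0×1+b≡1+n)))    → inj₂ (Equivalence.from ≡rot⇔ (inj₂ a≡0×1+b≡1+n))
      (inj₂ (inj₂ (inj₂ b≡0×1+a≡1+n)))    → inj₁ (Equivalence.from ≡rot⇔ (inj₂ b≡0×1+a≡1+n)))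
    (λ where
      (inj₁ b≡rot-a) → Sum.[ inj₁ , inj₂ ∘ inj₂ ∘ inj₂ ] (Equivalence.to ≡rot⇔ b≡rot-a)
      (inj₂ a≡rot-b) → Sum.[ inj₂ ∘ inj₁ , inj₂ ∘ inj₂ ∘ inj₁ ] (Equivalence.to ≡rot⇔ a≡rot-b))

  Edge-Cycle : Edge (Cycle (suc n)) a b ⇔ (b ≡ rot a ⊎ a ≡ rot b)
  Edge-Cycle {a} {b} = ⇔.trans (T-does (cycleAdjacent? (suc n) (toℕ a) (toℕ b))) cycleAdjacent⇔

  Cycle-rotate : Cycle (suc n) ≅ Cycle (suc n)
  Cycle-rotate = record
    { perm      = permutation rot unrot rot-unrot unrot-rot
    ; preserves = λ a b → does-⇔ (⇔.trans cycleAdjacent⇔ (⇔.trans rot-shift (⇔.sym cycleAdjacent⇔)))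
                                 (cycleAdjacent? (suc n) (toℕ (rot a)) (toℕ (rot b)))
                                 (cycleAdjacent? (suc n) (toℕ a) (toℕ b)) }
    where
    rot-shift : (rot b ≡ rot (rot a) ⊎ rot a ≡ rot (rot b)) ⇔ (b ≡ rot a ⊎ a ≡ rot b)
    rot-shift = mk⇔ (Sum.map rot-injective rot-injective) (Sum.map (cong rot) (cong rot))

  rotation : ℕ → Cycle (suc n) ≅ Cycle (suc n)
  rotation zero    = ≅-refl
  rotation (suc r) = ≅-trans (rotation r) Cycle-rotate

  rotation-rot : ∀ r a → to (rotation r) (rot a) ≡ rot (to (rotation r) a)
  rotation-rot zero    a = refl
  rotation-rot (suc r) a = cong rot (rotation-rot r a)

  rotation-+ : ∀ r₁ r₂ a → to (rotation (r₁ + r₂)) a ≡ to (rotation r₁) (to (rotation r₂) a)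
  rotation-+ zero     r₂ a = refl
  rotation-+ (suc r₁) r₂ a = cong rot (rotation-+ r₁ r₂ a)

  rotation-climb : ∀ d → toℕ a + d ≡ toℕ b → to (rotation d) a ≡ b
  rotation-climb zero a+0≡b = toℕ-injective (trans (sym (+-identityʳ _)) a+0≡b)
  rotation-climb {a} {b} (suc d) a+1+d≡b = begin
    rot (to (rotation d) a) ≡⟨ rotation-rot d a ⟨
    to (rotation d) (rot a) ≡⟨ rotation-climb d rot-a+d≡b ⟩
    b                       ∎
    where
    open ≡-Reasoning
    n≢a : n ≢ toℕ a
    n≢a n≡a = <-irrefl refl (<-≤-trans (subst (_< toℕ b) (sym n≡a) a<b) (≤-pred (toℕ<n b)))
      where a<b = ≤-trans (m<m+n (toℕ a) z<s) (≤-reflexive a+1+d≡b)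
    rot-a+d≡b : toℕ (rot a) + d ≡ toℕ b
    rot-a+d≡b = trans (cong (_+ d) (toℕ-rot n≢a)) (trans (sym (+-suc (toℕ a) d)) a+1+d≡b)

  rotation-transitive : ∀ a b → Σ ℕ λ r → to (rotation r) a ≡ b
  rotation-transitive a b = toℕ b + suc (n ∸ toℕ a) , (begin
    to (rotation (toℕ b + suc (n ∸ toℕ a))) a                 ≡⟨ rotation-+ (toℕ b) (suc (n ∸ toℕ a)) a ⟩
    to (rotation (toℕ b)) (rot (to (rotation (n ∸ toℕ a)) a)) ≡⟨ cong (to (rotation (toℕ b)) ∘ rot) a↦n ⟩
    to (rotation (toℕ b)) (rot (fromℕ n))                     ≡⟨ cong (to (rotation (toℕ b))) rot-fromℕ ⟩
    to (rotation (toℕ b)) zero                                ≡⟨ rotation-climb (toℕ b) refl ⟩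
    b                                                         ∎)
    where
    open ≡-Reasoning
    a↦n = rotation-climb (n ∸ toℕ a) (trans (m+[n∸m]≡n (≤-pred (toℕ<n a))) (sym (toℕ-fromℕ n)))

  -- Cycles

  openCycle : Graph (suc n)
  openCycle = delEdge (Cycle (suc n)) (fromℕ n) zero

  wrap-edge : Edge (Cycle (suc n)) (fromℕ n) zero
  wrap-edge = Equivalence.from Edge-Cycle (inj₁ (sym rot-fromℕ))

  Cycle-hasPath : HasPath (Cycle (suc n)) 0 n
  Cycle-hasPath a⋖b _ _ =
    Equivalence.from Edge-Cycle (inj₁ b≡rot-a) , Equivalence.from Edge-Cycle (inj₂ b≡rot-a)
    where b≡rot-a = Equivalence.from ≡rot⇔ (inj₁ (sym a⋖b))

  wrap-offPath : 2 ≤ n → OffPath (fromℕ n) zero 0 n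
  wrap-offPath 2≤n a⋖b _ _ (inj₁ (_ , refl))    = 0≢1+n a⋖b
  wrap-offPath 2≤n a⋖b _ _ (inj₂ (refl , refl)) = 1+n≰n (subst (2 ≤_) (trans (sym (toℕ-fromℕ n)) a⋖b) 2≤n)

  fromℕ-unique : suc (toℕ a) ≡ suc n → a ≡ fromℕ n
  fromℕ-unique 1+a≡1+n = toℕ-injective (trans (suc-injective 1+a≡1+n) (sym (toℕ-fromℕ n)))

  openCycle-confined : Confined openCycle 0 n
  openCycle-confined {a} {b} e _ = direction , z≤n , ≤-pred (toℕ<n b)
    where
    notWrap = delEdge-deleted (Cycle (suc n)) (fromℕ n) zero e
    direction : a ⋖ b ⊎ b ⋖ a
    direction with Equivalence.to (Edge-Cycle {a = a} {b = b}) (delEdge⁻ (Cycle (suc n)) (fromℕ n) zero {a} {b} e)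
    ... | inj₁ b≡rot-a = Sum.[ inj₁ ∘ sym , (λ (b≡0 , 1+a≡1+n) →
                                ⊥-elim (notWrap (inj₁ (fromℕ-unique 1+a≡1+n , toℕ-injective b≡0)))) ]
                              (Equivalence.to ≡rot⇔ b≡rot-a)
    ... | inj₂ a≡rot-b = Sum.[ inj₂ ∘ sym , (λ (a≡0 , 1+b≡1+n) →
                                ⊥-elim (notWrap (inj₂ (toℕ-injective a≡0 , fromℕ-unique 1+b≡1+n)))) ]
                              (Equivalence.to ≡rot⇔ a≡rot-b)

  openCycle-hasPath : 2 ≤ n → HasPath openCycle 0 n
  openCycle-hasPath 2≤n = HasPath-delEdge Cycle-hasPath (wrap-offPath 2≤n)

  openCycle-segment : 2 ≤ n → Segment openCycle 0 n
  openCycle-segment 2≤n = openCycle-confined , openCycle-hasPath 2≤n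

  rotation-wrap↦edge : b ≡ rot a → Σ ℕ λ r → to (rotation r) (fromℕ n) ≡ a × to (rotation r) zero ≡ b
  rotation-wrap↦edge {b} {a} b≡rot-a = r , n↦a , (begin
    to (rotation r) zero              ≡⟨ cong (to (rotation r)) rot-fromℕ ⟨
    to (rotation r) (rot (fromℕ n))   ≡⟨ rotation-rot r (fromℕ n) ⟩
    rot (to (rotation r) (fromℕ n))   ≡⟨ cong rot n↦a ⟩
    rot a                             ≡⟨ b≡rot-a ⟨
    b                                 ∎)
    where
    open ≡-Reasoning
    r = proj₁ (rotation-transitive (fromℕ n) a)
    n↦a = proj₂ (rotation-transitive (fromℕ n) a)

  openCycle-≅ : Edge (Cycle (suc n)) x y → openCycle ≅ delEdge (Cycle (suc n)) x y
  openCycle-≅ e with Equivalence.to Edge-Cycle e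
  ... | inj₁ y≡rot-x = delEdge-≅ (rotation (proj₁ R)) (inj₁ (proj₂ R)) where R = rotation-wrap↦edge y≡rot-x
  ... | inj₂ x≡rot-y = delEdge-≅ (rotation (proj₁ R)) (inj₂ (proj₂ R)) where R = rotation-wrap↦edge x≡rot-y

  Cycle-herderBound : ∀ t k → k ≤ 2 ^ t → k ≤ n → n ≤ k + k → 2 ≤ n →
                      ∀ v → HerderBound (Cycle (suc n)) v (2 + t)
  Cycle-herderBound t k k≤2^t k≤n n≤2k 2≤n v =
    subst (λ u → HerderBound (Cycle (suc n)) u (2 + t)) (proj₂ c↦v)
          (HerderBound-≅ (rotation (proj₁ c↦v)) herder-from-c)
    where
    c = fromℕ< (s≤s k≤n)
    c↦v = rotation-transitive c v
    near : ∀ w → w ≢ c → NearEnd t 0 n (toℕ w)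
    near w w≢c with toℕ w <? k
    ... | yes w<k = inj₁ (≤-trans w<k k≤2^t)
    ... | no w≮k with m≤n⇒m<n∨m≡n (≮⇒≥ w≮k)
    ...   | inj₁ k<w = inj₂ (≤-trans (s≤s n≤2k) (+-mono-≤ k<w k≤2^t))
    ...   | inj₂ k≡w = ⊥-elim (w≢c (toℕ-injective (trans (sym k≡w) (sym (toℕ-fromℕ< (s≤s k≤n))))))
    herder-from-c : HerderBound (Cycle (suc n)) c (2 + t)
    herder-from-c = cut (fromℕ n) zero wrap-edge λ w w≢c _ →
      herderBound-path t (openCycle-segment 2≤n) (n<1+n n) (z≤n , ≤-pred (toℕ<n w)) (near w w≢c)

  Cycle-catBound : ∀ t → 2 ≤ n → ⌊2^ t /2⌋ + ⌊2^ t /2⌋ < n → CatBound (Cycle (suc n)) zero (2 + t)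
  Cycle-catBound t 2≤n r+r<n =
    step (λ isolated → isolated (rot zero) (Equivalence.from Edge-Cycle (inj₁ refl))) λ x y e → inj₂ (move e)
    where
    move-in-openCycle : ∀ z → CatMove openCycle z (suc t)
    move-in-openCycle z =
      catMove-to t (proj₁ avoid) (openCycle-hasPath 2≤n) (n<1+n n) (≤-trans (s≤s z≤n) 2≤n)
        (z≤n , ≤-pred (toℕ<n z)) (proj₁ (proj₂ avoid)) (proj₂ (proj₂ avoid))
      where avoid = Central-avoiding ⌊2^ t /2⌋ (toℕ z) r+r<n
    move : Edge (Cycle (suc n)) x y → CatMove (delEdge (Cycle (suc n)) x y) zero (suc t)
    move {x} {y} e = subst (λ u → CatMove (delEdge (Cycle (suc n)) x y) u (suc t)) (to-from I zero)
                           (CatMove-≅ I (move-in-openCycle (from I zero)))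
      where I = openCycle-≅ e

CatNumber-Cycle : ∀ t k m → ⌊2^ t /2⌋ < k → k ≤ 2 ^ t → 3 ≤ m → k + k ≤ m → m ≤ suc (k + k) →
                  CatNumber (Cycle m) (2 + t)
CatNumber-Cycle t k (suc n) r<k k≤2^t 3≤m 2k≤m m≤2k+1 =
  (zero , Cycle-catBound t 2≤n r+r<n) , Cycle-herderBound t k k≤2^t k≤n (≤-pred m≤2k+1) 2≤n
  where
  2≤n = ≤-pred 3≤m
  k≤n = ≤-pred (≤-trans (≤-reflexive (+-comm 1 k)) (≤-trans (+-monoʳ-≤ k (≤-trans (s≤s z≤n) r<k)) 2k≤m))
  r+r<n = ≤-pred (≤-trans (≤-reflexive (cong suc (sym (+-suc _ _)))) (≤-trans (+-mono-≤ r<k r<k) 2k≤m))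

n≤2^⌈log2⌉n : ∀ n (rec : Acc _<_ n) → n ≤ 2 ^ ⌈log2⌉ n rec
n≤2^⌈log2⌉n zero                _         = z≤n
n≤2^⌈log2⌉n (suc zero)          _         = ≤-refl
n≤2^⌈log2⌉n (suc (suc n)) (acc rs) = begin
  2 + n                                 ≤⟨ s≤s (s≤s n≤⌈n/2⌉+⌈n/2⌉) ⟩
  2 + (⌈ n /2⌉ + ⌈ n /2⌉)               ≡⟨ cong suc (+-suc _ _) ⟨
  suc ⌈ n /2⌉ + suc ⌈ n /2⌉             ≤⟨ +-mono-≤ ih ih ⟩
  2 ^ L + 2 ^ L                         ≡⟨ cong (2 ^ L +_) (+-identityʳ (2 ^ L)) ⟨
  2 ^ suc L                             ∎
  where
  open ≤-Reasoning
  L = ⌈log2⌉ (suc ⌈ n /2⌉) (rs (⌈n/2⌉<n n))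
  ih = n≤2^⌈log2⌉n (suc ⌈ n /2⌉) (rs (⌈n/2⌉<n n))
  n≤⌈n/2⌉+⌈n/2⌉ = ≤-trans (≤-reflexive (sym (⌊n/2⌋+⌈n/2⌉≡n n))) (+-monoˡ-≤ ⌈ n /2⌉ (⌊n/2⌋≤⌈n/2⌉ n))

n≤2^⌈log₂n⌉ : ∀ n → n ≤ 2 ^ ⌈log₂ n ⌉
n≤2^⌈log₂n⌉ n = n≤2^⌈log2⌉n n (<-wellFounded n)

⌊2^⌈log₂n⌉/2⌋<n : ∀ n → 0 < n → ⌊2^ ⌈log₂ n ⌉ /2⌋ < n
⌊2^⌈log₂n⌉/2⌋<n n 0<n with ⌈log₂ n ⌉ in eq
... | zero  = 0<n
... | suc t = ≰⇒> λ n≤2^t →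
  1+n≰n (≤-trans (≤-reflexive (sym eq)) (≤-trans (⌈log₂⌉-mono-≤ n≤2^t) (≤-reflexive (⌈log₂2^n⌉≡n t))))

CatNumber-Cycle-⌈log₂⌉ : ∀ k m → 1 ≤ k → 3 ≤ m → 2 * k ≤ m → m ≤ 2 * k + 1 →
                         CatNumber (Cycle m) (⌈log₂ (2 * k) ⌉ + 1)
CatNumber-Cycle-⌈log₂⌉ k m 1≤k 3≤m 2k≤m m≤2k+1 =
  subst (CatNumber (Cycle m)) 2+⌈log₂k⌉≡⌈log₂2k⌉+1
    (CatNumber-Cycle ⌈log₂ k ⌉ k m (⌊2^⌈log₂n⌉/2⌋<n k 1≤k) (n≤2^⌈log₂n⌉ k) 3≤m
      (subst (_≤ m) 2*k≡k+k 2k≤m) (subst (m ≤_) (trans (cong (_+ 1) 2*k≡k+k) (+-comm _ 1)) m≤2k+1))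
  where
  2*k≡k+k : 2 * k ≡ k + k
  2*k≡k+k = cong (k +_) (+-identityʳ k)
  2+⌈log₂k⌉≡⌈log₂2k⌉+1 : 2 + ⌈log₂ k ⌉ ≡ ⌈log₂ (2 * k) ⌉ + 1
  2+⌈log₂k⌉≡⌈log₂2k⌉+1 =
    sym (trans (cong (_+ 1) (⌈log₂2*n⌉≡1+⌈log₂n⌉ k {{>-nonZero 1≤k}})) (+-comm (suc ⌈log₂ k ⌉) 1))

mainTheorem3 : ((k : ℕ) → 2 ≤ k →
                   CatNumber (Cycle (2 * k + 1)) (⌈log₂ (2 * k) ⌉ + 1)
                   × CatNumber (Cycle (2 * k)) (⌈log₂ (2 * k) ⌉ + 1))
                 × CatNumber (Cycle 3) 2
mainTheorem3 =
  (λ k 2≤k → CatNumber-Cycle-⌈log₂⌉ k (2 * k + 1) (1≤k 2≤k) (≤-trans (3≤2k 2≤k) (m≤m+n _ 1)) (m≤m+n _ 1) ≤-refl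
           , CatNumber-Cycle-⌈log₂⌉ k (2 * k) (1≤k 2≤k) (3≤2k 2≤k) ≤-refl (m≤m+n _ 1))
  , CatNumber-Cycle-⌈log₂⌉ 1 3 ≤-refl ≤-refl (s≤s (s≤s z≤n)) ≤-refl
  where
  1≤k : ∀ {k} → 2 ≤ k → 1 ≤ k
  1≤k = ≤-trans (s≤s z≤n)
  3≤2k : ∀ {k} → 2 ≤ k → 3 ≤ 2 * k
  3≤2k 2≤k = ≤-trans (n≤1+n 3) (*-monoʳ-≤ 2 2≤k)
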